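{- Let $\mathbb T$ be the Terwilliger $\mathbb F$-algebra of the factorial association scheme with parameters $u_1,\dots,u_n$ with respect to a fixed point $\mathbf x$, and let $n_2=|\{a\in[1,n]: u_a>2\}|$. Then $$\dim_{\mathbb F}\mathbb T=\sum_{g=0}^{n_2}\sum_{h=0}^{n-n_2}\sum_{i=0}^{g}\sum_{j=0}^{h}\binom{n_2}{g}\binom{n-n_2}{h}\binom{g}{i}\binom{h}{j}2^{\,n-g-h+i}.$$
   Context: Let $n\ge1$ and let $\mathbb U_1,\dots,\mathbb U_n$ be finite sets with $|\mathbb U_a|=u_a\ge 2$. Put $\mathbb X=\prod_{a=1}^n\mathbb U_a$ and $d=2^n-1$; write $[g,h]=\{a\in\mathbb Z: g\le a\le h\}$. For $g\in[0,d]$ with binary expansion $g=\sum_{a=1}^n g_{(a)}2^{a-1}$, $g_{(a)}\in\{0,1\}$, let $\mathbb P(g)=\{a: g_{(a)}=1\}$. For $\mathbf u\in\mathbb X$ let $\mathbf u_a$ be its $a$-th coordinate, and let $R_g=\{(\mathbf u,\mathbf v)\in\mathbb X\times\mathbb X:\ \mathbf u_a\ne\mathbf v_a\iff a\in\mathbb P(g)\}$. The partition $\mathbb S=\{R_0,\dots,R_d\}$ of $\mathbb X\times\mathbb X$ is the factorial association scheme with parameters $u_1,\dots,u_n$. Let $\mathbb F$ be any field. Let $A_g$ be the $\{0,1\}$-matrix in $M_{\mathbb X}(\mathbb F)$ with $A_g(\mathbf u,\mathbf v)=1$ iff $(\mathbf u,\mathbf v)\in R_g$. Fix $\mathbf x\in\mathbb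 X$ and let $E_g^*$ be the diagonal $\{0,1\}$-matrix in $M_{\mathbb X}(\mathbb F)$ with $E_g^*(\mathbf u,\mathbf u)=1$ iff $(\mathbf x,\mathbf u)\in R_g$. The Terwilliger $\mathbb F$-algebra $\mathbb T$ is the subalgebra of $M_{\mathbb X}(\mathbb F)$ generated by $A_0,\dots,A_d,E_0^*,\dots,E_d^*$. -}

module Defs where

open import Level using (Level; _⊔_)
open import Algebra.Bundles using (CommutativeRing)
open import Relation.Nullary using (¬_; does)
open import Data.Bool using (Bool; true; false; if_then_else_; not; _∧_)
import Data.Bool.Properties as BoolP
open import Data.Nat as ℕ using (ℕ; zero; suc; _<_; _^_; _∸_; _<?_)
open import Data.Nat.DivMod using (_/_; _%_)
open import Data.Nat.Combinatorics using (_C_)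
open import Data.Fin using (Fin; toℕ)
import Data.Fin.Properties as FinP
open import Data.List using (List; []; _∷_; foldr; map; concatMap; upTo; allFin; length; filter)
open import Data.Product using (Σ; _×_; _,_; ∃)
open import Relation.Binary.PropositionalEquality using (_≡_)
open import Data.Sum using (_⊎_; inj₁; inj₂)
open import Data.List.Relation.Unary.All using (all?)
open import Data.Nat.Properties using (_≟_; m^n≢0)
open import Data.Nat.ListAction using (sum)

record Field (c ℓ : Level) : Set (Level.suc (c ⊔ ℓ)) where
  field
    commutativeRing : CommutativeRing c ℓ
  open CommutativeRing commutativeRing public
  field
    1≉0     : ¬ (1# ≈ 0#)
    inverse : ∀ x → ¬ (x ≈ 0#) → Σ Carrier λ y → (x * y) ≈ 1#

Pt : (n : ℕ) → (Fin n → ℕ) → Set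
Pt n u = (a : Fin n) → Fin (u a)

consPt : ∀ {n} {u : Fin (suc n) → ℕ} → Fin (u Fin.zero) → Pt n (λ a → u (Fin.suc a)) → Pt (suc n) u
consPt i f Fin.zero    = i
consPt i f (Fin.suc a) = f a

allPt : (n : ℕ) (u : Fin n → ℕ) → List (Pt n u)
allPt zero    u = (λ ()) ∷ []
allPt (suc n) u = concatMap (λ i → map (consPt i) (allPt n (λ a → u (Fin.suc a)))) (allFin (u Fin.zero))

-- g_(a): the a-th binary digit of g (a counted from 0 here, i.e. the
-- paper's g_(a+1) for a ∈ Fin n ≅ [1,n])
bit : ℕ → ℕ → Bool
bit g a = does ((_/_ g (2 ^ a) ⦃ m^n≢0 2 a ⦄) % 2 ≟ 1)

-- (u,v) ∈ R_g  as a Boolean:  for all a,  (u_a ≠ v_a) ⇔ a ∈ P(g)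
inR : ∀ {n u} → Fin (2 ^ n) → Pt n u → Pt n u → Bool
inR {n} g x y =
  does (all? (λ a → BoolP._≟_ (not (does (FinP._≟_ (x a) (y a)))) (bit (toℕ g) (toℕ a))) (allFin n))

module Terwilliger {c ℓ : Level} (F : Field c ℓ) (n : ℕ) (u : Fin n → ℕ) where
  open Field F

  X : Set
  X = Pt n u

  Mat : Set c
  Mat = X → X → Carrier

  _≈M_ : Mat → Mat → Set ℓ
  M ≈M N = ∀ x y → M x y ≈ N x y

  ΣX : (X → Carrier) → Carrier
  ΣX f = foldr (λ w acc → f w + acc) 0# (allPt n u)

  _·M_ : Mat → Mat → Mat
  (M ·M N) x y = ΣX (λ w → M x w * N w y)

  _+M_ : Mat → Mat → Mat
  (M +M N) x y = M x y + N x y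

  _⋆M_ : Carrier → Mat → Mat
  (k ⋆M M) x y = k * M x y

  0M : Mat
  0M x y = 0#

  IM : Mat
  IM x y = if does (all? (λ a → FinP._≟_ (x a) (y a)) (allFin n)) then 1# else 0#

  A : Fin (2 ^ n) → Mat
  A g x y = if inR g x y then 1# else 0#

  E* : X → Fin (2 ^ n) → Mat
  E* x₀ g x y = if inR g x₀ x ∧ does (all? (λ a → FinP._≟_ (x a) (y a)) (allFin n)) then 1# else 0#

  Gen : Set
  Gen = Fin (2 ^ n) ⊎ Fin (2 ^ n)

  gen : X → Gen → Mat
  gen x₀ (inj₁ g) = A g
  gen x₀ (inj₂ g) = E* x₀ g

  word : X → List Gen → Mat
  word x₀ = foldr (λ s M → gen x₀ s ·M M) IM

  lincomb : X → List (Carrier × List Gen) → Mat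
  lincomb x₀ = foldr (λ { (k , w) M → (k ⋆M word x₀ w) +M M }) 0M

  -- membership in T = the subalgebra generated by the A_g and E*_g,
  -- i.e. the F-span of all finite products of generators
  InT : X → Mat → Set (c ⊔ ℓ)
  InT x₀ M = Σ (List (Carrier × List Gen)) λ l → M ≈M lincomb x₀ l

  combo : (k : ℕ) → (Fin k → Carrier) → (Fin k → Mat) → Mat
  combo zero    cs B = 0M
  combo (suc k) cs B = (cs Fin.zero ⋆M B Fin.zero) +M combo k (λ i → cs (Fin.suc i)) (λ i → B (Fin.suc i))

  record IsBasisOfT (x₀ : X) (k : ℕ) (B : Fin k → Mat) : Set (c ⊔ ℓ) where
    field
      inT         : ∀ i → InT x₀ (B i)
      independent : ∀ (cs : Fin k → Carrier) → combo k cs B ≈M 0M → ∀ i → cs i ≈ 0#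
      spanning    : ∀ M → InT x₀ M → Σ (Fin k → Carrier) λ cs → M ≈M combo k cs B

  DimT≡ : X → ℕ → Set (c ⊔ ℓ)
  DimT≡ x₀ k = Σ (Fin k → Mat) λ B → IsBasisOfT x₀ k B

Σ[≤] : ℕ → (ℕ → ℕ) → ℕ
Σ[≤] m f = sum (map f (upTo (suc m)))

n₂ : (n : ℕ) → (Fin n → ℕ) → ℕ
n₂ n u = length (filter (λ a → 2 <? u a) (allFin n))

formula : (n : ℕ) → (Fin n → ℕ) → ℕ
formula n u =
  Σ[≤] m λ g → Σ[≤] (n ∸ m) λ h → Σ[≤] g λ i → Σ[≤] h λ j →
    (m C g) ℕ.* ((n ∸ m) C h) ℕ.* (g C i) ℕ.* (h C j) ℕ.* 2 ^ (n ∸ g ∸ h ℕ.+ i)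
  where m = n₂ n u

{-# OPTIONS --safe #-}

-- The stabiliser of x in ∏_a Sym(U_a) preserves every relation R_g and fixes x,
-- so every generator of T is invariant under it, and invariance survives sums and
-- products (a product sums over X, and the summation can be reindexed by the
-- permutation).  The orbits of the stabiliser on X × X are read off coordinatewise
-- from the equality type of (x_a, p_a, q_a): five types when u_a > 2, four when
-- u_a = 2, as three distinct points need u_a ≥ 3.  The indicator of an orbit equals
-- E*_G A_H E*_K, where G, H, K record in which coordinates p differs from x, q from
-- p, and q from x.  So the orbit indicators form a basis of T, and T has dimension
-- 5 ^ n₂ * 4 ^ (n - n₂).  The stated sum has this value by the binomial theorem:
-- the sums over j, i, h, g give 2 ^ h, 3 ^ g, 4 ^ (n - n₂) and 5 ^ n₂.

module Submission where

open import Defs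
open import Data.Nat using (ℕ; _≤_)
open import Data.Fin using (Fin)

open import Algebra.Bundles using (CommutativeMonoid)
open import Data.Nat using (_<?_)
open import Function using (id; _∘_)
import Relation.Binary.PropositionalEquality as ≡
open ≡ using (_≡_)
open import Data.Product using (_,_)

module MixedRadix where

  open import Data.Nat using (zero; suc; _*_)
  open import Data.Fin using (combine; remQuot)
  open import Data.Fin.Properties using (remQuot-combine; combine-remQuot)
  open import Data.Product using (proj₁; proj₂)
  open import Relation.Binary.PropositionalEquality
  open ≡-Reasoning

  ∏ : ∀ n → (Fin n → ℕ) → ℕ
  ∏ zero    c = 1
  ∏ (suc n) c = c Fin.zero * ∏ n (c ∘ Fin.suc)

  tupleToFin : ∀ n (c : Fin n → ℕ) → ((a : Fin n) → Fin (c a)) → Fin (∏ n c)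
  tupleToFin zero    c t = Fin.zero
  tupleToFin (suc n) c t = combine (t Fin.zero) (tupleToFin n (c ∘ Fin.suc) (t ∘ Fin.suc))

  finToTuple : ∀ n (c : Fin n → ℕ) → Fin (∏ n c) → (a : Fin n) → Fin (c a)
  finToTuple (suc n) c j Fin.zero    = proj₁ (remQuot {c Fin.zero} (∏ n (c ∘ Fin.suc)) j)
  finToTuple (suc n) c j (Fin.suc a) =
    finToTuple n (c ∘ Fin.suc) (proj₂ (remQuot {c Fin.zero} (∏ n (c ∘ Fin.suc)) j)) a

  tupleToFin-cong : ∀ n c {t t′ : (a : Fin n) → Fin (c a)} →
    (∀ a → t a ≡ t′ a) → tupleToFin n c t ≡ tupleToFin n c t′
  tupleToFin-cong zero    c t≗t′ = refl
  tupleToFin-cong (suc n) c t≗t′ =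
    cong₂ combine (t≗t′ Fin.zero) (tupleToFin-cong n (c ∘ Fin.suc) (t≗t′ ∘ Fin.suc))

  remQuot-tupleToFin : ∀ n c t → remQuot {c Fin.zero} (∏ n (c ∘ Fin.suc)) (tupleToFin (suc n) c t)
                                  ≡ (t Fin.zero , tupleToFin n (c ∘ Fin.suc) (t ∘ Fin.suc))
  remQuot-tupleToFin n c t = remQuot-combine (t Fin.zero) (tupleToFin n (c ∘ Fin.suc) (t ∘ Fin.suc))

  finToTuple-tupleToFin : ∀ n c t (a : Fin n) → finToTuple n c (tupleToFin n c t) a ≡ t a
  finToTuple-tupleToFin (suc n) c t Fin.zero    = cong proj₁ (remQuot-tupleToFin n c t)
  finToTuple-tupleToFin (suc n) c t (Fin.suc a) = begin
    finToTuple (suc n) c (tupleToFin (suc n) c t) (Fin.suc a)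
      ≡⟨ cong (λ rq → finToTuple n (c ∘ Fin.suc) (proj₂ rq) a) (remQuot-tupleToFin n c t) ⟩
    finToTuple n (c ∘ Fin.suc) (tupleToFin n (c ∘ Fin.suc) (t ∘ Fin.suc)) a
      ≡⟨ finToTuple-tupleToFin n (c ∘ Fin.suc) (t ∘ Fin.suc) a ⟩
    t (Fin.suc a) ∎

  tupleToFin-finToTuple : ∀ n c j → tupleToFin n c (finToTuple n c j) ≡ j
  tupleToFin-finToTuple zero    c Fin.zero = refl
  tupleToFin-finToTuple (suc n) c j = begin
    combine (proj₁ rq) (tupleToFin n (c ∘ Fin.suc) (finToTuple n (c ∘ Fin.suc) (proj₂ rq)))
      ≡⟨ cong (combine (proj₁ rq)) (tupleToFin-finToTuple n (c ∘ Fin.suc) (proj₂ rq)) ⟩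
    combine (proj₁ rq) (proj₂ rq)
      ≡⟨ combine-remQuot {c Fin.zero} (∏ n (c ∘ Fin.suc)) j ⟩
    j ∎
    where
    rq = remQuot {c Fin.zero} (∏ n (c ∘ Fin.suc)) j

module Counting where

  open import Data.Nat
  open import Data.Nat.Properties
  open import Data.Nat.Combinatorics using (_C_)
  open import Data.Fin using (toℕ)
  open import Data.Fin.Properties using (toℕ<n)
  open import Data.Bool using (true; false; if_then_else_)
  open import Data.List using (applyUpTo; map; filter; length; tabulate; allFin)
  open import Data.List.Properties using (length-filter; length-tabulate)
  open import Data.Nat.ListAction using (sum)
  open import Data.Nat.Tactic.RingSolver using (solve-∀)
  open import Relation.Nullary using (does)
  open import Relation.Unary using (Pred; Decidable)
  open import Relation.Binary.PropositionalEquality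
  import Algebra.Properties.Semiring.Sum +-*-semiring as ∑
  import Algebra.Properties.CommutativeSemiring.Binomial +-*-commutativeSemiring as Binomial
  import Algebra.Properties.Semiring.Exp +-*-semiring as Exp
  import Algebra.Definitions.RawMonoid +-0-rawMonoid as Mult
  open ∑ using (sum-syntax; sum⁺-syntax)
  open ≡-Reasoning
  open MixedRadix using (∏)

  sum-applyUpTo : ∀ k (f g : ℕ → ℕ) → sum (map f (applyUpTo g k)) ≡ ∑[ i < k ] f (g (toℕ i))
  sum-applyUpTo zero    f g = refl
  sum-applyUpTo (suc k) f g = cong (f (g 0) +_) (sum-applyUpTo k f (g ∘ suc))

  Σ[≤]≡∑ : ∀ m f → Σ[≤] m f ≡ ∑[ i ≤ m ] f (toℕ i)
  Σ[≤]≡∑ m f = sum-applyUpTo (suc m) f id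

  Σ[≤]-cong : ∀ m {f g : ℕ → ℕ} → (∀ k → k ≤ m → f k ≡ g k) → Σ[≤] m f ≡ Σ[≤] m g
  Σ[≤]-cong m {f} {g} f≗g = begin
    Σ[≤] m f                ≡⟨ Σ[≤]≡∑ m f ⟩
    ∑[ i ≤ m ] f (toℕ i)    ≡⟨ ∑.sum-cong-≗ (λ i → f≗g (toℕ i) (≤-pred (toℕ<n i))) ⟩
    ∑[ i ≤ m ] g (toℕ i)    ≡⟨ Σ[≤]≡∑ m g ⟨
    Σ[≤] m g                ∎

  Σ[≤]-distribˡ : ∀ c m f → c * Σ[≤] m f ≡ Σ[≤] m (λ k → c * f k)
  Σ[≤]-distribˡ c m f = begin
    c * Σ[≤] m f                ≡⟨ cong (c *_) (Σ[≤]≡∑ m f) ⟩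
    c * (∑[ i ≤ m ] f (toℕ i))  ≡⟨ ∑.*-distribˡ-sum {suc m} c (λ i → f (toℕ i)) ⟩
    ∑[ i ≤ m ] (c * f (toℕ i))  ≡⟨ Σ[≤]≡∑ m _ ⟨
    Σ[≤] m (λ k → c * f k)      ∎

  Σ[≤]-distribʳ : ∀ c m f → Σ[≤] m f * c ≡ Σ[≤] m (λ k → f k * c)
  Σ[≤]-distribʳ c m f = begin
    Σ[≤] m f * c                ≡⟨ cong (_* c) (Σ[≤]≡∑ m f) ⟩
    (∑[ i ≤ m ] f (toℕ i)) * c  ≡⟨ ∑.*-distribʳ-sum {suc m} c (λ i → f (toℕ i)) ⟩
    ∑[ i ≤ m ] (f (toℕ i) * c)  ≡⟨ Σ[≤]≡∑ m _ ⟨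
    Σ[≤] m (λ k → f k * c)      ∎

  Σ[≤]-separate : ∀ m N (X Y : ℕ → ℕ → ℕ) →
    Σ[≤] m (λ g → Σ[≤] N λ h → Σ[≤] g λ i → Σ[≤] h λ j → X g i * Y h j)
    ≡ Σ[≤] m (λ g → Σ[≤] g (X g)) * Σ[≤] N (λ h → Σ[≤] h (Y h))
  Σ[≤]-separate m N X Y = begin
    Σ[≤] m (λ g → Σ[≤] N λ h → Σ[≤] g λ i → Σ[≤] h λ j → X g i * Y h j)
      ≡⟨ Σ[≤]-cong m (λ g _ → Σ[≤]-cong N λ h _ → Σ[≤]-cong g λ i _ →
           sym (Σ[≤]-distribˡ (X g i) h (Y h))) ⟩
    Σ[≤] m (λ g → Σ[≤] N λ h → Σ[≤] g λ i → X g i * Σ[≤] h (Y h))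
      ≡⟨ Σ[≤]-cong m (λ g _ → Σ[≤]-cong N λ h _ → sym (Σ[≤]-distribʳ (Σ[≤] h (Y h)) g (X g))) ⟩
    Σ[≤] m (λ g → Σ[≤] N λ h → Σ[≤] g (X g) * Σ[≤] h (Y h))
      ≡⟨ Σ[≤]-cong m (λ g _ → sym (Σ[≤]-distribˡ (Σ[≤] g (X g)) N λ h → Σ[≤] h (Y h))) ⟩
    Σ[≤] m (λ g → Σ[≤] g (X g) * Σ[≤] N (λ h → Σ[≤] h (Y h)))
      ≡⟨ Σ[≤]-distribʳ _ m (λ g → Σ[≤] g (X g)) ⟨
    Σ[≤] m (λ g → Σ[≤] g (X g)) * Σ[≤] N (λ h → Σ[≤] h (Y h)) ∎

  ^≡Exp^ : ∀ x k → x ^ k ≡ x Exp.^ k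
  ^≡Exp^ x zero    = refl
  ^≡Exp^ x (suc k) = cong (x *_) (^≡Exp^ x k)

  *≡Mult× : ∀ k x → k * x ≡ k Mult.× x
  *≡Mult× zero    x = refl
  *≡Mult× (suc k) x = cong (x +_) (*≡Mult× k x)

  Σ[≤]-binomial : ∀ n x y → Σ[≤] n (λ k → (n C k) * (x ^ k * y ^ (n ∸ k))) ≡ (x + y) ^ n
  Σ[≤]-binomial n x y = begin
    Σ[≤] n (λ k → (n C k) * (x ^ k * y ^ (n ∸ k)))
      ≡⟨ Σ[≤]≡∑ n _ ⟩
    ∑[ k ≤ n ] ((n C toℕ k) * (x ^ toℕ k * y ^ (n ∸ toℕ k)))
      ≡⟨ ∑.sum-cong-≗ {y = Binomial.binomialTerm x y n} binomialTerm≡ ⟩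
    Binomial.binomialExpansion x y n
      ≡⟨ Binomial.theorem n x y ⟨
    (x + y) Exp.^ n
      ≡⟨ ^≡Exp^ (x + y) n ⟨
    (x + y) ^ n ∎
    where
    binomialTerm≡ : ∀ k → (n C toℕ k) * (x ^ toℕ k * y ^ (n ∸ toℕ k)) ≡ Binomial.binomialTerm x y n k
    binomialTerm≡ k = begin
      (n C toℕ k) * (x ^ toℕ k * y ^ (n ∸ toℕ k))
        ≡⟨ *≡Mult× (n C toℕ k) _ ⟩
      (n C toℕ k) Mult.× (x ^ toℕ k * y ^ (n ∸ toℕ k))
        ≡⟨ cong₂ (λ a b → (n C toℕ k) Mult.× (a * b)) (^≡Exp^ x (toℕ k)) (^≡Exp^ y (n ∸ toℕ k)) ⟩
      Binomial.binomialTerm x y n k ∎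

  Σ[≤]-binomial₁ : ∀ n x → Σ[≤] n (λ k → (n C k) * x ^ k) ≡ (x + 1) ^ n
  Σ[≤]-binomial₁ n x =
    trans (Σ[≤]-cong n λ k _ → cong ((n C k) *_) (sym (x^k*1^l≡x^k k (n ∸ k)))) (Σ[≤]-binomial n x 1)
    where
    x^k*1^l≡x^k : ∀ k l → x ^ k * 1 ^ l ≡ x ^ k
    x^k*1^l≡x^k k l = trans (cong (x ^ k *_) (^-zeroˡ l)) (*-identityʳ (x ^ k))

  Σ[≤]-iterated-binomial : ∀ m x y →
    Σ[≤] m (λ g → Σ[≤] g λ i → ((m C g) * y ^ (m ∸ g)) * ((g C i) * x ^ i)) ≡ (x + 1 + y) ^ m
  Σ[≤]-iterated-binomial m x y = begin
    Σ[≤] m (λ g → Σ[≤] g λ i → ((m C g) * y ^ (m ∸ g)) * ((g C i) * x ^ i))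
      ≡⟨ Σ[≤]-cong m (λ g _ → Σ[≤]-distribˡ ((m C g) * y ^ (m ∸ g)) g λ i → (g C i) * x ^ i) ⟨
    Σ[≤] m (λ g → ((m C g) * y ^ (m ∸ g)) * Σ[≤] g λ i → (g C i) * x ^ i)
      ≡⟨ Σ[≤]-cong m (λ g _ → cong (((m C g) * y ^ (m ∸ g)) *_) (Σ[≤]-binomial₁ g x)) ⟩
    Σ[≤] m (λ g → ((m C g) * y ^ (m ∸ g)) * (x + 1) ^ g)
      ≡⟨ Σ[≤]-cong m (λ g _ → rearrange (m C g) (y ^ (m ∸ g)) ((x + 1) ^ g)) ⟩
    Σ[≤] m (λ g → (m C g) * ((x + 1) ^ g * y ^ (m ∸ g)))
      ≡⟨ Σ[≤]-binomial m (x + 1) y ⟩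
    (x + 1 + y) ^ m ∎
    where
    rearrange : ∀ a b c → (a * b) * c ≡ a * (c * b)
    rearrange = solve-∀

  exponent-split : ∀ {m N g h} i → g ≤ m → h ≤ N → m + N ∸ g ∸ h + i ≡ (m ∸ g + i) + (N ∸ h)
  exponent-split {m} {N} {g} {h} i g≤m h≤N = begin
    m + N ∸ g ∸ h + i        ≡⟨ cong (λ z → z ∸ h + i) (+-∸-comm N g≤m) ⟩
    m ∸ g + N ∸ h + i        ≡⟨ cong (_+ i) (+-∸-assoc (m ∸ g) h≤N) ⟩
    m ∸ g + (N ∸ h) + i      ≡⟨ +-comm-middle (m ∸ g) (N ∸ h) i ⟩
    m ∸ g + i + (N ∸ h)      ∎
    where
    +-comm-middle : ∀ a b c → a + b + c ≡ a + c + b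
    +-comm-middle = solve-∀

  fourfold-sum : ∀ m N n → n ≡ m + N →
    Σ[≤] m (λ g → Σ[≤] N λ h → Σ[≤] g λ i → Σ[≤] h λ j →
      (m C g) * (N C h) * (g C i) * (h C j) * 2 ^ (n ∸ g ∸ h + i))
    ≡ 5 ^ m * 4 ^ N
  fourfold-sum m N .(m + N) refl = begin
    Σ[≤] m (λ g → Σ[≤] N λ h → Σ[≤] g λ i → Σ[≤] h λ j →
      (m C g) * (N C h) * (g C i) * (h C j) * 2 ^ (m + N ∸ g ∸ h + i))
      ≡⟨ Σ[≤]-cong m (λ g g≤m → Σ[≤]-cong N λ h h≤N → Σ[≤]-cong g λ i _ → Σ[≤]-cong h λ j _ →
           term≡X*Y g≤m h≤N i j) ⟩
    Σ[≤] m (λ g → Σ[≤] N λ h → Σ[≤] g λ i → Σ[≤] h λ j → X g i * Y h j)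
      ≡⟨ Σ[≤]-separate m N X Y ⟩
    Σ[≤] m (λ g → Σ[≤] g (X g)) * Σ[≤] N (λ h → Σ[≤] h (Y h))
      ≡⟨ cong₂ _*_ (Σ[≤]-iterated-binomial m 2 2) (Σ[≤]-iterated-binomial N 1 2) ⟩
    5 ^ m * 4 ^ N ∎
    where
    X Y : ℕ → ℕ → ℕ
    X g i = ((m C g) * 2 ^ (m ∸ g)) * ((g C i) * 2 ^ i)
    Y h j = ((N C h) * 2 ^ (N ∸ h)) * ((h C j) * 1 ^ j)

    rearrange : ∀ a b c d e f o → a * b * c * d * ((e * f) * o) ≡ (a * e) * (c * f) * ((b * o) * (d * 1))
    rearrange = solve-∀

    term≡X*Y : ∀ {g h} → g ≤ m → h ≤ N → ∀ i j →
      (m C g) * (N C h) * (g C i) * (h C j) * 2 ^ (m + N ∸ g ∸ h + i) ≡ X g i * Y h j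
    term≡X*Y {g} {h} g≤m h≤N i j = begin
      (m C g) * (N C h) * (g C i) * (h C j) * 2 ^ (m + N ∸ g ∸ h + i)
        ≡⟨ cong (λ e → (m C g) * (N C h) * (g C i) * (h C j) * 2 ^ e) (exponent-split i g≤m h≤N) ⟩
      (m C g) * (N C h) * (g C i) * (h C j) * 2 ^ ((m ∸ g + i) + (N ∸ h))
        ≡⟨ cong (λ e → (m C g) * (N C h) * (g C i) * (h C j) * e)
             (trans (^-distribˡ-+-* 2 (m ∸ g + i) (N ∸ h))
                    (cong (_* 2 ^ (N ∸ h)) (^-distribˡ-+-* 2 (m ∸ g) i))) ⟩
      (m C g) * (N C h) * (g C i) * (h C j) * ((2 ^ (m ∸ g) * 2 ^ i) * 2 ^ (N ∸ h))
        ≡⟨ rearrange (m C g) (N C h) (g C i) (h C j) (2 ^ (m ∸ g)) (2 ^ i) (2 ^ (N ∸ h)) ⟩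
      X g i * (((N C h) * 2 ^ (N ∸ h)) * ((h C j) * 1))
        ≡⟨ cong (λ e → X g i * (((N C h) * 2 ^ (N ∸ h)) * ((h C j) * e))) (^-zeroˡ j) ⟨
      X g i * Y h j ∎

  n₂≤n : ∀ n u → n₂ n u ≤ n
  n₂≤n n u = subst (n₂ n u ≤_) (length-tabulate id) (length-filter (λ a → 2 <? u a) (allFin n))

  formula-closed-form : ∀ n u → formula n u ≡ 5 ^ n₂ n u * 4 ^ (n ∸ n₂ n u)
  formula-closed-form n u = fourfold-sum (n₂ n u) (n ∸ n₂ n u) n (sym (m+[n∸m]≡n (n₂≤n n u)))

  ∏-if : ∀ {a p} {A : Set a} {P : Pred A p} (P? : Decidable P) x y n (f : Fin n → A) →
    ∏ n (λ k → if does (P? (f k)) then x else y)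
    ≡ x ^ length (filter P? (tabulate f)) * y ^ (n ∸ length (filter P? (tabulate f)))
  ∏-if P? x y zero    f = refl
  ∏-if P? x y (suc n) f with does (P? (f Fin.zero)) | ∏-if P? x y n (f ∘ Fin.suc)
  ... | true  | ih = trans (cong (x *_) ih) (sym (*-assoc x _ _))
  ... | false | ih = begin
    y * ∏ n (λ k → if does (P? (f (Fin.suc k))) then x else y)  ≡⟨ cong (y *_) ih ⟩
    y * (x ^ m * y ^ (n ∸ m))                                    ≡⟨ swap-left y (x ^ m) _ ⟩
    x ^ m * y ^ suc (n ∸ m)                                      ≡⟨ cong (λ e → x ^ m * y ^ e) (+-∸-assoc 1 m≤n) ⟨
    x ^ m * y ^ (suc n ∸ m)                                      ∎
    where
    m = length (filter P? (tabulate (f ∘ Fin.suc)))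
    m≤n : m ≤ n
    m≤n = subst (m ≤_) (length-tabulate (f ∘ Fin.suc)) (length-filter P? (tabulate (f ∘ Fin.suc)))
    swap-left : ∀ a b c → a * (b * c) ≡ b * (a * c)
    swap-left = solve-∀

module BinaryDigits where

  open import Data.Nat
  open import Data.Nat.Properties
  open import Data.Nat.DivMod
  open import Data.Nat.Divisibility using (divides-refl)
  open import Data.Fin using (toℕ; fromℕ<)
  open import Data.Fin.Properties using (toℕ-fromℕ<)
  open import Data.Bool using (Bool; true; false)
  open import Relation.Nullary using (does)
  open import Relation.Binary.PropositionalEquality

  bitValue : Bool → ℕ
  bitValue false = 0
  bitValue true  = 1

  -- little-endian, like bit: the digit v a has weight 2 ^ a
  fromBitsℕ : ∀ n → (Fin n → Bool) → ℕ
  fromBitsℕ zero    v = 0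
  fromBitsℕ (suc n) v = bitValue (v Fin.zero) + fromBitsℕ n (v ∘ Fin.suc) * 2

  fromBitsℕ< : ∀ n v → fromBitsℕ n v < 2 ^ n
  fromBitsℕ< zero    v = s≤s z≤n
  fromBitsℕ< (suc n) v = begin-strict
    bitValue (v Fin.zero) + e * 2   <⟨ +-monoˡ-< (e * 2) (bitValue<2 (v Fin.zero)) ⟩
    2 + e * 2                       ≡⟨ *-comm (suc e) 2 ⟩
    2 * suc e                       ≤⟨ *-monoʳ-≤ 2 (fromBitsℕ< n (v ∘ Fin.suc)) ⟩
    2 * 2 ^ n                       ∎
    where
    open ≤-Reasoning
    e = fromBitsℕ n (v ∘ Fin.suc)
    bitValue<2 : ∀ b → bitValue b < 2
    bitValue<2 false = s≤s z≤n
    bitValue<2 true  = s≤s (s≤s z≤n)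

  fromBits : ∀ n → (Fin n → Bool) → Fin (2 ^ n)
  fromBits n v = fromℕ< (fromBitsℕ< n v)

  bit-zero : ∀ b e → bit (bitValue b + e * 2) 0 ≡ b
  bit-zero b e = begin
    does ((bitValue b + e * 2) / 1 % 2 ≟ 1)  ≡⟨ cong (λ m → does (m % 2 ≟ 1)) (n/1≡n (bitValue b + e * 2)) ⟩
    does ((bitValue b + e * 2) % 2 ≟ 1)      ≡⟨ cong (λ m → does (m ≟ 1)) ([m+kn]%n≡m%n (bitValue b) e 2) ⟩
    does (bitValue b % 2 ≟ 1)                ≡⟨ lowest b ⟩
    b                                        ∎
    where
    open ≡-Reasoning
    lowest : ∀ b → does (bitValue b % 2 ≟ 1) ≡ b
    lowest false = refl
    lowest true  = refl

  bit-suc : ∀ g a → bit g (suc a) ≡ bit (g / 2) a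
  bit-suc g a =
    cong (λ m → does (m % 2 ≟ 1)) (sym (m/n/o≡m/[n*o] g 2 (2 ^ a) ⦃ _ ⦄ ⦃ m^n≢0 2 a ⦄ ⦃ m^n≢0 2 (suc a) ⦄))

  [b+e*2]/2≡e : ∀ b e → (bitValue b + e * 2) / 2 ≡ e
  [b+e*2]/2≡e false e = m*n/n≡m e 2
  [b+e*2]/2≡e true  e = trans (+-distrib-/-∣ʳ 1 {d = 2} (divides-refl e)) (m*n/n≡m e 2)

  bit-fromBitsℕ : ∀ n v (a : Fin n) → bit (fromBitsℕ n v) (toℕ a) ≡ v a
  bit-fromBitsℕ (suc n) v Fin.zero    = bit-zero (v Fin.zero) (fromBitsℕ n (v ∘ Fin.suc))
  bit-fromBitsℕ (suc n) v (Fin.suc a) = begin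
    bit (fromBitsℕ (suc n) v) (suc (toℕ a))   ≡⟨ bit-suc (fromBitsℕ (suc n) v) (toℕ a) ⟩
    bit (fromBitsℕ (suc n) v / 2) (toℕ a)     ≡⟨ cong (λ m → bit m (toℕ a)) ([b+e*2]/2≡e (v Fin.zero) _) ⟩
    bit (fromBitsℕ n (v ∘ Fin.suc)) (toℕ a)   ≡⟨ bit-fromBitsℕ n (v ∘ Fin.suc) a ⟩
    v (Fin.suc a)                             ∎
    where open ≡-Reasoning

  bit-fromBits : ∀ n v (a : Fin n) → bit (toℕ (fromBits n v)) (toℕ a) ≡ v a
  bit-fromBits n v a =
    trans (cong (λ m → bit m (toℕ a)) (toℕ-fromℕ< (fromBitsℕ< n v))) (bit-fromBitsℕ n v a)

module EqualityTypes where

  open import Data.Nat as ℕ using (zero; suc; _<_; z≤n; s≤s; _<?_)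
  open import Data.Nat.Properties using (≤-refl; ≤-reflexive; n≤1+n; ≤∧≢⇒<; ≤-pred)
  open import Data.Fin using (punchIn; _≟_)
  open import Data.Fin.Patterns using (0F; 1F; 2F)
  open import Data.Fin.Properties using (punchInᵢ≢i; punchIn-injective; injective⇒≤)
  open import Data.Fin.Permutation as Perm using (Permutation′; _⟨$⟩ʳ_; _⟨$⟩ˡ_; transpose; _∘ₚ_)
  open import Data.Bool using (Bool; true; false; not; if_then_else_)
  open import Data.Product using (Σ; _×_; _,_; proj₁; proj₂)
  open import Data.Vec using ([]; _∷_; lookup)
  open import Data.Empty using (⊥-elim)
  open import Function using (_⇔_; mk⇔; Equivalence)
  import Function.Properties.Equivalence as ⇔
  open import Relation.Nullary using (does; yes; no; ¬_)
  open import Relation.Nullary.Decidable using (dec-true; dec-false)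
  open import Relation.Binary.PropositionalEquality

  differ : ∀ {k} → Fin k → Fin k → Bool
  differ i j = not (does (i ≟ j))

  differ-refl : ∀ {k} (i : Fin k) → differ i i ≡ false
  differ-refl i = cong not (dec-true (i ≟ i) refl)

  differ-≢ : ∀ {k} {i j : Fin k} → i ≢ j → differ i j ≡ true
  differ-≢ {i = i} {j} i≢j = cong not (dec-false (i ≟ j) i≢j)

  differ-≡⇒⇔ : ∀ {k} {i j i′ j′ : Fin k} → differ i j ≡ differ i′ j′ → (i ≡ j ⇔ i′ ≡ j′)
  differ-≡⇒⇔ {i = i} {j} {i′} {j′} e with i ≟ j | i′ ≟ j′
  ... | yes i≡j | yes i′≡j′ = mk⇔ (λ _ → i′≡j′) (λ _ → i≡j)
  ... | no  i≢j | no  i′≢j′ = mk⇔ (⊥-elim ∘ i≢j) (⊥-elim ∘ i′≢j′)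

  -- The equality type of (o, p, q), computed from (differ o p, differ o q, differ p q):
  -- 0 : o = p = q,  1 : o = p ≠ q,  2 : o = q ≠ p,  3 : o ≠ p = q,  4 : all distinct.
  eqTypeOf : Bool → Bool → Bool → ℕ
  eqTypeOf false false _     = 0
  eqTypeOf false true  _     = 1
  eqTypeOf true  false _     = 2
  eqTypeOf true  true  false = 3
  eqTypeOf true  true  true  = 4

  eqType : ∀ {k} (o p q : Fin k) → ℕ
  eqType o p q = eqTypeOf (differ o p) (differ o q) (differ p q)

  opBit : ℕ → Bool
  opBit 0 = false
  opBit 1 = false
  opBit _ = true

  oqBit : ℕ → Bool
  oqBit 0 = false
  oqBit 1 = true
  oqBit 2 = false
  oqBit _ = true

  pqBit : ℕ → Bool
  pqBit 0 = false
  pqBit 1 = true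
  pqBit 2 = true
  pqBit 3 = false
  pqBit _ = true

  opBit-eqTypeOf : ∀ r s t → opBit (eqTypeOf r s t) ≡ r
  opBit-eqTypeOf false false _     = refl
  opBit-eqTypeOf false true  _     = refl
  opBit-eqTypeOf true  false _     = refl
  opBit-eqTypeOf true  true  false = refl
  opBit-eqTypeOf true  true  true  = refl

  oqBit-eqTypeOf : ∀ r s t → oqBit (eqTypeOf r s t) ≡ s
  oqBit-eqTypeOf false false _     = refl
  oqBit-eqTypeOf false true  _     = refl
  oqBit-eqTypeOf true  false _     = refl
  oqBit-eqTypeOf true  true  false = refl
  oqBit-eqTypeOf true  true  true  = refl

  -- eqTypeOf ignores its third argument unless the first two are true, so this needs
  -- transitivity of ≡.
  pqBit-eqType : ∀ {k} (o p q : Fin k) → pqBit (eqType o p q) ≡ differ p q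
  pqBit-eqType o p q with o ≟ p | o ≟ q | p ≟ q
  ... | yes o≡p | yes o≡q | yes p≡q = refl
  ... | yes o≡p | yes o≡q | no  p≢q = ⊥-elim (p≢q (trans (sym o≡p) o≡q))
  ... | yes o≡p | no  o≢q | yes p≡q = ⊥-elim (o≢q (trans o≡p p≡q))
  ... | yes o≡p | no  o≢q | no  p≢q = refl
  ... | no  o≢p | yes o≡q | yes p≡q = ⊥-elim (o≢p (trans o≡q (sym p≡q)))
  ... | no  o≢p | yes o≡q | no  p≢q = refl
  ... | no  o≢p | no  o≢q | yes p≡q = refl
  ... | no  o≢p | no  o≢q | no  p≢q = refl

  eqTypeOf-bits : ∀ t → t < 5 → eqTypeOf (opBit t) (oqBit t) (pqBit t) ≡ t
  eqTypeOf-bits 0 _ = refl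
  eqTypeOf-bits 1 _ = refl
  eqTypeOf-bits 2 _ = refl
  eqTypeOf-bits 3 _ = refl
  eqTypeOf-bits 4 _ = refl
  eqTypeOf-bits (suc (suc (suc (suc (suc _))))) (s≤s (s≤s (s≤s (s≤s (s≤s ())))))

  eqTypeOf<5 : ∀ r s t → eqTypeOf r s t < 5
  eqTypeOf<5 false false _     = s≤s z≤n
  eqTypeOf<5 false true  _     = s≤s (s≤s z≤n)
  eqTypeOf<5 true  false _     = s≤s (s≤s (s≤s z≤n))
  eqTypeOf<5 true  true  false = s≤s (s≤s (s≤s (s≤s z≤n)))
  eqTypeOf<5 true  true  true  = ≤-refl

  eqType≡eqTypeOf : ∀ {k} (o p q : Fin k) {r s t} → differ o p ≡ r → differ o q ≡ s → differ p q ≡ t →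
    eqType o p q ≡ eqTypeOf r s t
  eqType≡eqTypeOf o p q refl refl refl = refl

  eqType≡⇔ : ∀ {k} (o p q : Fin k) {t} → t < 5 →
    eqType o p q ≡ t ⇔ (differ o p ≡ opBit t × differ p q ≡ pqBit t × differ o q ≡ oqBit t)
  eqType≡⇔ o p q {t} t<5 = mk⇔
    (λ { refl → sym (opBit-eqTypeOf _ _ _) , sym (pqBit-eqType o p q) , sym (oqBit-eqTypeOf _ _ _) })
    (λ (op , pq , oq) → trans (eqType≡eqTypeOf o p q op oq pq) (eqTypeOf-bits t t<5))

  differ-true⇒≢ : ∀ {k} {i j : Fin k} → differ i j ≡ true → i ≢ j
  differ-true⇒≢ {i = i} d refl with () ← trans (sym d) (differ-refl i)

  distinct⇒3≤ : ∀ {k} {o p q : Fin k} → o ≢ p → o ≢ q → p ≢ q → 3 ≤ k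
  distinct⇒3≤ {o = o} {p} {q} o≢p o≢q p≢q = injective⇒≤ {f = lookup (o ∷ p ∷ q ∷ [])} injective
    where
    injective : ∀ {a b} → lookup (o ∷ p ∷ q ∷ []) a ≡ lookup (o ∷ p ∷ q ∷ []) b → a ≡ b
    injective {0F} {0F} _ = refl
    injective {0F} {1F} e = ⊥-elim (o≢p e)
    injective {0F} {2F} e = ⊥-elim (o≢q e)
    injective {1F} {0F} e = ⊥-elim (o≢p (sym e))
    injective {1F} {1F} _ = refl
    injective {1F} {2F} e = ⊥-elim (p≢q e)
    injective {2F} {0F} e = ⊥-elim (o≢q (sym e))
    injective {2F} {1F} e = ⊥-elim (p≢q (sym e))
    injective {2F} {2F} _ = refl

  eqType≡4⇒3≤ : ∀ {k} (o p q : Fin k) → eqType o p q ≡ 4 → 3 ≤ k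
  eqType≡4⇒3≤ o p q e = distinct⇒3≤ {o = o} {p} {q} (differ-true⇒≢ op) (differ-true⇒≢ oq) (differ-true⇒≢ pq)
    where
    op = proj₁ (Equivalence.to (eqType≡⇔ o p q ≤-refl) e)
    pq = proj₁ (proj₂ (Equivalence.to (eqType≡⇔ o p q ≤-refl) e))
    oq = proj₂ (proj₂ (Equivalence.to (eqType≡⇔ o p q ≤-refl) e))

  -- the number of equality types of triples in Fin k, when k ≥ 2
  #eqTypes : ℕ → ℕ
  #eqTypes k = if does (2 <? k) then 5 else 4

  #eqTypes-yes : ∀ {k} → 2 < k → #eqTypes k ≡ 5
  #eqTypes-yes {k} 2<k = cong (if_then 5 else 4) (dec-true (2 <? k) 2<k)

  #eqTypes-no : ∀ {k} → ¬ 2 < k → #eqTypes k ≡ 4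
  #eqTypes-no {k} 2≮k = cong (if_then 5 else 4) (dec-false (2 <? k) 2≮k)

  #eqTypes≤5 : ∀ k → #eqTypes k ≤ 5
  #eqTypes≤5 k with 2 <? k
  ... | yes 2<k = ≤-reflexive (#eqTypes-yes 2<k)
  ... | no  2≮k = subst (_≤ 5) (sym (#eqTypes-no 2≮k)) (n≤1+n 4)

  eqType<#eqTypes : ∀ {k} (o p q : Fin k) → eqType o p q < #eqTypes k
  eqType<#eqTypes {k} o p q with 2 <? k | eqType o p q ℕ.≟ 4
  ... | yes 2<k | _       = subst (eqType o p q <_) (sym (#eqTypes-yes 2<k)) (eqTypeOf<5 _ _ _)
  ... | no  2≮k | yes e   = ⊥-elim (2≮k (eqType≡4⇒3≤ o p q e))
  ... | no  2≮k | no  e≢4 =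
    subst (eqType o p q <_) (sym (#eqTypes-no 2≮k)) (≤∧≢⇒< (≤-pred (eqTypeOf<5 _ _ _)) e≢4)

  ≢punchIn : ∀ {k} (o : Fin (suc k)) i → o ≢ punchIn o i
  ≢punchIn o i = punchInᵢ≢i o i ∘ sym

  eqType-surjective : ∀ {k} → 2 ≤ k → (o : Fin k) → ∀ t → t < #eqTypes k →
    Σ (Fin k × Fin k) λ (p , q) → eqType o p q ≡ t
  eqType-surjective (s≤s (s≤s _)) o 0 _ =
    (o , o) , eqType≡eqTypeOf o o o (differ-refl o) (differ-refl o) (differ-refl o)
  eqType-surjective (s≤s (s≤s _)) o 1 _ =
    (o , o′) , eqType≡eqTypeOf o o o′ (differ-refl o) (differ-≢ (≢punchIn o 0F)) (differ-≢ (≢punchIn o 0F))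
    where o′ = punchIn o 0F
  eqType-surjective (s≤s (s≤s _)) o 2 _ =
    (o′ , o) , eqType≡eqTypeOf o o′ o (differ-≢ (≢punchIn o 0F)) (differ-refl o) (differ-≢ (≢punchIn o 0F ∘ sym))
    where o′ = punchIn o 0F
  eqType-surjective (s≤s (s≤s _)) o 3 _ =
    (o′ , o′) , eqType≡eqTypeOf o o′ o′ (differ-≢ (≢punchIn o 0F)) (differ-≢ (≢punchIn o 0F)) (differ-refl o′)
    where o′ = punchIn o 0F
  eqType-surjective {2} _ o 4 (s≤s (s≤s (s≤s (s≤s ()))))
  eqType-surjective {suc (suc (suc _))} _ o 4 _ =
    (p , q) , eqType≡eqTypeOf o p q (differ-≢ (≢punchIn o 0F)) (differ-≢ (≢punchIn o 1F)) (differ-≢ p≢q)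
    where
    p = punchIn o 0F
    q = punchIn o 1F
    p≢q : p ≢ q
    p≢q p≡q with () ← punchIn-injective o 0F 1F p≡q
  eqType-surjective {2} _ o (suc (suc (suc (suc (suc _))))) (s≤s (s≤s (s≤s (s≤s ()))))
  eqType-surjective {suc (suc (suc _))} _ o (suc (suc (suc (suc (suc _))))) (s≤s (s≤s (s≤s (s≤s (s≤s ())))))

  transpose-sends : ∀ {k} (i j : Fin k) → transpose i j ⟨$⟩ʳ i ≡ j
  transpose-sends i j with i ≟ i
  ... | yes _   = refl
  ... | no  i≢i = ⊥-elim (i≢i refl)

  transpose-fixes : ∀ {k} {i j l : Fin k} → (l ≡ i ⇔ l ≡ j) → transpose i j ⟨$⟩ʳ l ≡ l
  transpose-fixes {i = i} {j} {l} l≡i⇔l≡j with l ≟ i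
  ... | yes l≡i = sym (Equivalence.to l≡i⇔l≡j l≡i)
  ... | no  l≢i with l ≟ j
  ...   | yes l≡j = ⊥-elim (l≢i (Equivalence.from l≡i⇔l≡j l≡j))
  ...   | no  _   = refl

  ⟨$⟩ʳ-injective : ∀ {k} (π : Permutation′ k) {i j} → π ⟨$⟩ʳ i ≡ π ⟨$⟩ʳ j → i ≡ j
  ⟨$⟩ʳ-injective π {i} {j} e = trans (sym (Perm.inverseˡ π)) (trans (cong (π ⟨$⟩ˡ_) e) (Perm.inverseˡ π))

  moved-≡⇔ : ∀ {k} (π : Permutation′ k) {a b c} → π ⟨$⟩ʳ a ≡ b → (b ≡ π ⟨$⟩ʳ c ⇔ a ≡ c)
  moved-≡⇔ π πa≡b = mk⇔ (λ b≡πc → ⟨$⟩ʳ-injective π (trans πa≡b b≡πc)) (λ { refl → sym πa≡b })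

  -- First move p to p′, then the image of q to q′; the hypotheses make sure
  -- that neither transposition disturbs the points already in place.
  perm-fixing-moving : ∀ {k} {o p q p′ q′ : Fin k} →
    (o ≡ p ⇔ o ≡ p′) → (o ≡ q ⇔ o ≡ q′) → (p ≡ q ⇔ p′ ≡ q′) →
    Σ (Permutation′ k) λ π → π ⟨$⟩ʳ o ≡ o × π ⟨$⟩ʳ p ≡ p′ × π ⟨$⟩ʳ q ≡ q′
  perm-fixing-moving {o = o} {p} {q} {p′} {q′} o≡p⇔ o≡q⇔ p≡q⇔ =
    τ₁ ∘ₚ τ₂ , fixes-o , sends-p , transpose-sends q₁ q′
    where
    τ₁ = transpose p p′
    q₁ = τ₁ ⟨$⟩ʳ q
    τ₂ = transpose q₁ q′
    τ₁o≡o : τ₁ ⟨$⟩ʳ o ≡ o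
    τ₁o≡o = transpose-fixes o≡p⇔
    fixes-o : τ₂ ⟨$⟩ʳ (τ₁ ⟨$⟩ʳ o) ≡ o
    fixes-o = trans (cong (τ₂ ⟨$⟩ʳ_) τ₁o≡o) (transpose-fixes (⇔.trans (moved-≡⇔ τ₁ τ₁o≡o) o≡q⇔))
    sends-p : τ₂ ⟨$⟩ʳ (τ₁ ⟨$⟩ʳ p) ≡ p′
    sends-p = trans (cong (τ₂ ⟨$⟩ʳ_) (transpose-sends p p′))
                    (transpose-fixes (⇔.trans (moved-≡⇔ τ₁ (transpose-sends p p′)) p≡q⇔))

  eqType-≡⇒perm : ∀ {k} {o p q p′ q′ : Fin k} → eqType o p q ≡ eqType o p′ q′ →
    Σ (Permutation′ k) λ π → π ⟨$⟩ʳ o ≡ o × π ⟨$⟩ʳ p ≡ p′ × π ⟨$⟩ʳ q ≡ q′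
  eqType-≡⇒perm {o = o} {p} {q} {p′} {q′} e = perm-fixing-moving
    (differ-≡⇒⇔ (through opBit (opBit-eqTypeOf _ _ _) (opBit-eqTypeOf _ _ _)))
    (differ-≡⇒⇔ (through oqBit (oqBit-eqTypeOf _ _ _) (oqBit-eqTypeOf _ _ _)))
    (differ-≡⇒⇔ (through pqBit (pqBit-eqType o p q) (pqBit-eqType o p′ q′)))
    where
    through : ∀ (bitOf : ℕ → Bool) {d d′} → bitOf (eqType o p q) ≡ d → bitOf (eqType o p′ q′) ≡ d′ → d ≡ d′
    through bitOf l r = trans (sym l) (trans (cong bitOf e) r)

module PointSums {c ℓ} (M : CommutativeMonoid c ℓ) where

  open import Data.Nat using (zero; suc)
  open import Data.Fin using (punchIn)
  open import Data.Fin.Properties using (punchInᵢ≢i)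
  open import Data.Fin.Permutation using (Permutation′; _⟨$⟩ʳ_)
  open import Data.List using (List; []; _∷_; _++_; map; concatMap; foldr; tabulate; allFin)
  open import Relation.Nullary using (¬_)
  open ≡ using (_≢_)

  open CommutativeMonoid M
  open import Algebra.Properties.CommutativeMonoid.Sum M
    using (sum; sum-cong-≋; sum-remove; sum-replicate-zero; sum-permute)
  open import Relation.Binary.Reasoning.Setoid setoid

  ∑L : {A : Set} → (A → Carrier) → List A → Carrier
  ∑L f = foldr (λ w acc → f w ∙ acc) ε

  ∑L-cong : ∀ {A : Set} {f g : A → Carrier} xs → (∀ w → f w ≈ g w) → ∑L f xs ≈ ∑L g xs
  ∑L-cong []       f≈g = refl
  ∑L-cong (x ∷ xs) f≈g = ∙-cong (f≈g x) (∑L-cong xs f≈g)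

  ∑L-++ : ∀ {A : Set} (f : A → Carrier) xs ys → ∑L f (xs ++ ys) ≈ ∑L f xs ∙ ∑L f ys
  ∑L-++ f []       ys = sym (identityˡ _)
  ∑L-++ f (x ∷ xs) ys = trans (∙-congˡ (∑L-++ f xs ys)) (sym (assoc _ _ _))

  ∑L-map : ∀ {A B : Set} (f : B → Carrier) (h : A → B) xs → ∑L f (map h xs) ≡ ∑L (f ∘ h) xs
  ∑L-map f h []       = ≡.refl
  ∑L-map f h (x ∷ xs) = ≡.cong (f (h x) ∙_) (∑L-map f h xs)

  ∑L-concatMap : ∀ {A B : Set} (f : B → Carrier) (h : A → List B) xs →
    ∑L f (concatMap h xs) ≈ ∑L (∑L f ∘ h) xs
  ∑L-concatMap f h []       = refl
  ∑L-concatMap f h (x ∷ xs) = trans (∑L-++ f (h x) (concatMap h xs)) (∙-congˡ (∑L-concatMap f h xs))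

  ∑L-tabulate : ∀ {A : Set} (f : A → Carrier) {k} (h : Fin k → A) → ∑L f (tabulate h) ≡ sum (f ∘ h)
  ∑L-tabulate f {zero}  h = ≡.refl
  ∑L-tabulate f {suc k} h = ≡.cong (f (h Fin.zero) ∙_) (∑L-tabulate f (h ∘ Fin.suc))

  ∑L-ε : ∀ {A : Set} (xs : List A) {g : A → Carrier} → (∀ x → g x ≈ ε) → ∑L g xs ≈ ε
  ∑L-ε []       g≈ε = refl
  ∑L-ε (x ∷ xs) g≈ε = trans (∙-cong (g≈ε x) (∑L-ε xs g≈ε)) (identityʳ ε)

  sum-δ : ∀ {k} (f : Fin k → Carrier) i → (∀ j → j ≢ i → f j ≈ ε) → sum f ≈ f i
  sum-δ {suc k} f i f≈ε = begin
    sum f                      ≈⟨ sum-remove f ⟩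
    f i ∙ sum (f ∘ punchIn i)  ≈⟨ ∙-congˡ (sum-cong-≋ (λ j → f≈ε _ (punchInᵢ≢i i j))) ⟩
    f i ∙ sum {k} (λ _ → ε)    ≈⟨ ∙-congˡ (sum-replicate-zero k) ⟩
    f i ∙ ε                    ≈⟨ identityʳ (f i) ⟩
    f i                        ∎

  module _ {n : ℕ} {u : Fin n → ℕ} where

    -- for the additive monoid of F this is ΣX, definitionally
    ∑Pt : (Pt n u → Carrier) → Carrier
    ∑Pt f = ∑L f (allPt n u)

    infix 4 _≋_
    _≋_ : Pt n u → Pt n u → Set
    x ≋ y = ∀ a → x a ≡ y a

    -- needed because ≡ on points, which are functions, is not extensional
    Respects≋ : (Pt n u → Carrier) → Set ℓ
    Respects≋ f = ∀ {x y} → x ≋ y → f x ≈ f y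

    act : ((a : Fin n) → Permutation′ (u a)) → Pt n u → Pt n u
    act π x a = π a ⟨$⟩ʳ x a

  ∑Pt-cong : ∀ {n u} {f g : Pt n u → Carrier} → (∀ x → f x ≈ g x) → ∑Pt f ≈ ∑Pt g
  ∑Pt-cong {n} {u} = ∑L-cong (allPt n u)

  ∑Pt-suc : ∀ {n} {u : Fin (suc n) → ℕ} (f : Pt (suc n) u → Carrier) →
    ∑Pt f ≈ sum {u Fin.zero} λ i → ∑Pt (f ∘ consPt i)
  ∑Pt-suc {n} {u} f = begin
    ∑Pt f
      ≈⟨ ∑L-concatMap f (λ i → map (consPt i) (allPt n _)) (allFin (u Fin.zero)) ⟩
    ∑L (λ i → ∑L f (map (consPt i) (allPt n _))) (allFin _)
      ≈⟨ ∑L-cong (allFin _) (λ i → reflexive (∑L-map f (consPt i) (allPt n _))) ⟩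
    ∑L (λ i → ∑Pt (f ∘ consPt i)) (allFin _)
      ≡⟨ ∑L-tabulate (λ i → ∑Pt (f ∘ consPt i)) {u Fin.zero} id ⟩
    sum (λ i → ∑Pt (f ∘ consPt i)) ∎

  consPt-cong : ∀ {n} {u : Fin (suc n) → ℕ} (i : Fin (u Fin.zero)) {x y : Pt n (u ∘ Fin.suc)} →
    x ≋ y → consPt {u = u} i x ≋ consPt i y
  consPt-cong i x≋y Fin.zero    = ≡.refl
  consPt-cong i x≋y (Fin.suc a) = x≋y a

  ∑Pt-permute : ∀ {n u} (π : (a : Fin n) → Permutation′ (u a)) {f : Pt n u → Carrier} →
    Respects≋ f → ∑Pt f ≈ ∑Pt (f ∘ act π)
  ∑Pt-permute {zero}      π f-resp = ∙-congʳ (f-resp λ ())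
  ∑Pt-permute {suc n} {u} π {f} f-resp = begin
    ∑Pt f
      ≈⟨ ∑Pt-suc f ⟩
    sum (λ i → ∑Pt (f ∘ consPt i))
      ≈⟨ sum-permute _ (π Fin.zero) ⟩
    sum (λ i → ∑Pt (f ∘ consPt (π Fin.zero ⟨$⟩ʳ i)))
      ≈⟨ sum-cong-≋ (λ i → ∑Pt-permute (π ∘ Fin.suc) (f-resp ∘ consPt-cong (π Fin.zero ⟨$⟩ʳ i))) ⟩
    sum (λ i → ∑Pt (f ∘ consPt (π Fin.zero ⟨$⟩ʳ i) ∘ act (π ∘ Fin.suc)))
      ≈⟨ sum-cong-≋ (λ i → ∑Pt-cong (λ x → f-resp (act-consPt i x))) ⟩
    sum (λ i → ∑Pt (f ∘ act π ∘ consPt i))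
      ≈⟨ ∑Pt-suc (f ∘ act π) ⟨
    ∑Pt (f ∘ act π) ∎
    where
    act-consPt : ∀ i x → consPt (π Fin.zero ⟨$⟩ʳ i) (act (π ∘ Fin.suc) x) ≋ act π (consPt i x)
    act-consPt i x Fin.zero    = ≡.refl
    act-consPt i x (Fin.suc a) = ≡.refl

  ∑Pt-δ : ∀ {n u} (z : Pt n u) {f : Pt n u → Carrier} →
    Respects≋ f → (∀ x → ¬ z ≋ x → f x ≈ ε) → ∑Pt f ≈ f z
  ∑Pt-δ {zero}      z f-resp f≈ε = trans (identityʳ _) (f-resp λ ())
  ∑Pt-δ {suc n} {u} z {f} f-resp f≈ε = begin
    ∑Pt f
      ≈⟨ ∑Pt-suc f ⟩
    sum (λ i → ∑Pt (f ∘ consPt i))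
      ≈⟨ sum-δ _ (z Fin.zero) off-slice ⟩
    ∑Pt (f ∘ consPt (z Fin.zero))
      ≈⟨ ∑Pt-δ (z ∘ Fin.suc) (f-resp ∘ consPt-cong (z Fin.zero)) (λ x z′≭x → f≈ε _ (z′≭x ∘ (_∘ Fin.suc))) ⟩
    f (consPt (z Fin.zero) (z ∘ Fin.suc))
      ≈⟨ f-resp consPt-η ⟩
    f z ∎
    where
    off-slice : ∀ i → i ≢ z Fin.zero → ∑Pt (f ∘ consPt i) ≈ ε
    off-slice i i≢z₀ = ∑L-ε (allPt n _) (λ x → f≈ε _ (λ z≋ → i≢z₀ (≡.sym (z≋ Fin.zero))))
    consPt-η : consPt (z Fin.zero) (z ∘ Fin.suc) ≋ z
    consPt-η Fin.zero    = ≡.refl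
    consPt-η (Fin.suc a) = ≡.refl

module Orbits {c ℓ} (F : Field c ℓ) {n : ℕ} {u : Fin n → ℕ} (x₀ : Pt n u) where

  open import Data.Nat using (zero; suc; _^_; _<_)
  open import Data.Nat.Properties using (<-≤-trans)
  open import Data.Fin using (toℕ; fromℕ<; _≟_)
  open import Data.Fin.Properties using (toℕ-fromℕ<; toℕ-injective; toℕ<n)
  open import Data.Fin.Permutation as Perm using (Permutation′; _⟨$⟩ʳ_)
  open import Data.Bool using (Bool; true; false; not; _∧_; if_then_else_)
  import Data.Bool.Properties as Bool
  open import Data.List using (List; []; _∷_; allFin)
  open import Data.List.Relation.Unary.All as All using (All; all?)
  open import Data.List.Relation.Unary.All.Properties using (tabulate⁺; tabulate⁻)
  open import Data.Product using (Σ; _×_; _,_; proj₁; proj₂)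
  open import Data.Product.Function.NonDependent.Propositional using (_×-⇔_)
  open import Data.Sum using (inj₁; inj₂)
  open import Function using (_⇔_; mk⇔; Equivalence)
  import Function.Properties.Equivalence as ⇔
  open import Relation.Nullary using (¬_; does; Dec)
  open import Relation.Nullary.Decidable using (dec-true; dec-false; does-⇔; _×-dec_)
  open import Relation.Unary using (Decidable)
  open ≡ using (_≢_)

  open MixedRadix
  open BinaryDigits using (fromBits; bit-fromBits)
  open EqualityTypes
  open Field F
  open Terwilliger F n u
  open PointSums +-commutativeMonoid
  open import Algebra.Properties.CommutativeMonoid.Sum +-commutativeMonoid using (sum)
  open import Relation.Binary.Reasoning.Setoid setoid

  ⟦_⟧ : Bool → Carrier
  ⟦ b ⟧ = if b then 1# else 0#

  ⟦does⟧-yes : ∀ {P : Set} (P? : Dec P) → P → ⟦ does P? ⟧ ≈ 1#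
  ⟦does⟧-yes P? p = reflexive (≡.cong ⟦_⟧ (dec-true P? p))

  ⟦does⟧-no : ∀ {P : Set} (P? : Dec P) → ¬ P → ⟦ does P? ⟧ ≈ 0#
  ⟦does⟧-no P? ¬p = reflexive (≡.cong ⟦_⟧ (dec-false P? ¬p))

  ⟦∧⟧ : ∀ a b → ⟦ a ∧ b ⟧ ≈ ⟦ a ⟧ * ⟦ b ⟧
  ⟦∧⟧ true  b = sym (*-identityˡ ⟦ b ⟧)
  ⟦∧⟧ false b = sym (zeroˡ ⟦ b ⟧)

  does-all?-cong : ∀ {P Q : Fin n → Set} (P? : Decidable P) (Q? : Decidable Q) →
    (∀ a → P a ⇔ Q a) → does (all? P? (allFin n)) ≡ does (all? Q? (allFin n))
  does-all?-cong P? Q? P⇔Q =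
    does-⇔ (mk⇔ (All.map (Equivalence.to (P⇔Q _))) (All.map (Equivalence.from (P⇔Q _))))
           (all? P? (allFin n)) (all? Q? (allFin n))

  samePt : Pt n u → Pt n u → Bool
  samePt x y = does (all? (λ a → x a ≟ y a) (allFin n))

  samePt-≋ : ∀ {x y} → x ≋ y → samePt x y ≡ true
  samePt-≋ x≋y = dec-true (all? _ (allFin n)) (tabulate⁺ x≋y)

  samePt-≭ : ∀ {x y} → ¬ x ≋ y → samePt x y ≡ false
  samePt-≭ x≭y = dec-false (all? _ (allFin n)) (x≭y ∘ tabulate⁻)

  SameCoincidences : Pt n u → Pt n u → Pt n u → Pt n u → Set
  SameCoincidences x y x′ y′ = ∀ a → x a ≡ y a ⇔ x′ a ≡ y′ a

  samePt-cong : ∀ {x y x′ y′} → SameCoincidences x y x′ y′ → samePt x y ≡ samePt x′ y′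
  samePt-cong = does-all?-cong _ _

  inR-cong : ∀ g {x y x′ y′} → SameCoincidences x y x′ y′ → inR g x y ≡ inR g x′ y′
  inR-cong g {x} {y} {x′} {y′} same = does-all?-cong _ _ λ a →
    let d≡d′ = ≡.cong not (does-⇔ (same a) (x a ≟ y a) (x′ a ≟ y′ a))
    in mk⇔ (≡.trans (≡.sym d≡d′)) (≡.trans d≡d′)

  record Stabiliser : Set where
    field
      perm  : (a : Fin n) → Permutation′ (u a)
      fixes : act perm x₀ ≋ x₀

  open Stabiliser

  identity : Stabiliser
  identity = record { perm = λ _ → Perm.id ; fixes = λ _ → ≡.refl }

  act-coincidences : ∀ π {x y x′ y′} → act π x ≋ x′ → act π y ≋ y′ → SameCoincidences x y x′ y′
  act-coincidences π πx≋x′ πy≋y′ a = mk⇔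
    (λ x≡y → ≡.trans (≡.sym (πx≋x′ a)) (≡.trans (≡.cong (π a ⟨$⟩ʳ_) x≡y) (πy≋y′ a)))
    (λ x′≡y′ → ⟨$⟩ʳ-injective (π a) (≡.trans (πx≋x′ a) (≡.trans x′≡y′ (≡.sym (πy≋y′ a)))))

  Invariant : Mat → Set ℓ
  Invariant M = ∀ σ {x y x′ y′} → act (perm σ) x ≋ x′ → act (perm σ) y ≋ y′ → M x y ≈ M x′ y′

  invariant-respects : ∀ {M} → Invariant M → ∀ {x y x′ y′} → x ≋ x′ → y ≋ y′ → M x y ≈ M x′ y′
  invariant-respects M-inv = M-inv identity

  ·M-respects : ∀ {M N} → Invariant M → Invariant N → ∀ p q → Respects≋ (λ w → M p w * N w q)
  ·M-respects M-inv N-inv p q w≋w′ =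
    *-cong (invariant-respects M-inv (λ _ → ≡.refl) w≋w′) (invariant-respects N-inv w≋w′ (λ _ → ≡.refl))

  IM-invariant : Invariant IM
  IM-invariant σ πx≋x′ πy≋y′ =
    reflexive (≡.cong ⟦_⟧ (samePt-cong (act-coincidences (perm σ) πx≋x′ πy≋y′)))

  A-invariant : ∀ g → Invariant (A g)
  A-invariant g σ πx≋x′ πy≋y′ =
    reflexive (≡.cong ⟦_⟧ (inR-cong g (act-coincidences (perm σ) πx≋x′ πy≋y′)))

  E*-invariant : ∀ g → Invariant (E* x₀ g)
  E*-invariant g σ πx≋x′ πy≋y′ = reflexive (≡.cong ⟦_⟧ (≡.cong₂ _∧_
    (inR-cong g (act-coincidences (perm σ) (fixes σ) πx≋x′))
    (samePt-cong (act-coincidences (perm σ) πx≋x′ πy≋y′))))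

  ·M-invariant : ∀ {M N} → Invariant M → Invariant N → Invariant (M ·M N)
  ·M-invariant {M} {N} M-inv N-inv σ {x} {y} {x′} {y′} πx≋x′ πy≋y′ = begin
    ∑Pt (λ w → M x w * N w y)
      ≈⟨ ∑Pt-cong (λ w → *-cong (M-inv σ {y = w} πx≋x′ (λ _ → ≡.refl)) (N-inv σ {x = w} (λ _ → ≡.refl) πy≋y′)) ⟩
    ∑Pt (λ w → M x′ (act π w) * N (act π w) y′)
      ≈⟨ ∑Pt-permute π (·M-respects M-inv N-inv x′ y′) ⟨
    ∑Pt (λ w → M x′ w * N w y′) ∎
    where
    π = perm σ

  +M-invariant : ∀ {M N} → Invariant M → Invariant N → Invariant (M +M N)
  +M-invariant M-inv N-inv σ πx≋x′ πy≋y′ = +-cong (M-inv σ πx≋x′ πy≋y′) (N-inv σ πx≋x′ πy≋y′)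

  ⋆M-invariant : ∀ k {M} → Invariant M → Invariant (k ⋆M M)
  ⋆M-invariant k M-inv σ πx≋x′ πy≋y′ = *-congˡ (M-inv σ πx≋x′ πy≋y′)

  word-invariant : ∀ w → Invariant (word x₀ w)
  word-invariant []            = IM-invariant
  word-invariant (inj₁ g ∷ w) = ·M-invariant (A-invariant g) (word-invariant w)
  word-invariant (inj₂ g ∷ w) = ·M-invariant (E*-invariant g) (word-invariant w)

  lincomb-invariant : ∀ l → Invariant (lincomb x₀ l)
  lincomb-invariant []            σ _ _ = refl
  lincomb-invariant ((k , w) ∷ l) = +M-invariant (⋆M-invariant k (word-invariant w)) (lincomb-invariant l)

  eqTypeAt : Pt n u → Pt n u → Fin n → ℕ
  eqTypeAt p q a = eqType (x₀ a) (p a) (q a)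

  invariant-eqTypeAt : ∀ {M} → Invariant M → ∀ {p q p′ q′} →
    (∀ a → eqTypeAt p q a ≡ eqTypeAt p′ q′ a) → M p q ≈ M p′ q′
  invariant-eqTypeAt M-inv same = M-inv σ (λ a → proj₁ (proj₂ (moves a))) (λ a → proj₂ (proj₂ (moves a)))
    where
    moves = λ a → proj₂ (eqType-≡⇒perm {o = x₀ a} (same a))
    σ = record { perm = λ a → proj₁ (eqType-≡⇒perm {o = x₀ a} (same a)) ; fixes = λ a → proj₁ (moves a) }

  #orbits : ℕ
  #orbits = ∏ n (#eqTypes ∘ u)

  -- the orbit of (p, q) under the stabiliser of x₀, as the mixed-radix code of its equality types
  orbitDigits : Pt n u → Pt n u → (a : Fin n) → Fin (#eqTypes (u a))
  orbitDigits p q a = fromℕ< (eqType<#eqTypes (x₀ a) (p a) (q a))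

  orbit : Pt n u → Pt n u → Fin #orbits
  orbit p q = tupleToFin n (#eqTypes ∘ u) (orbitDigits p q)

  typeOf : Fin #orbits → Fin n → ℕ
  typeOf j a = toℕ (finToTuple n (#eqTypes ∘ u) j a)

  orbit≡⇔ : ∀ {p q j} → orbit p q ≡ j ⇔ (∀ a → eqTypeAt p q a ≡ typeOf j a)
  orbit≡⇔ {p} {q} {j} = mk⇔
    (λ orbit≡j a → ≡.trans (≡.sym (toℕ-fromℕ< _))
                   (≡.trans (≡.cong toℕ (≡.sym (finToTuple-tupleToFin n _ (orbitDigits p q) a)))
                            (≡.cong (λ i → typeOf i a) orbit≡j)))
    (λ types → ≡.trans (tupleToFin-cong n _ λ a → toℕ-injective (≡.trans (toℕ-fromℕ< _) (types a)))
                       (tupleToFin-finToTuple n _ j))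

  orbit-≡⇒eqTypeAt : ∀ {p q p′ q′} → orbit p q ≡ orbit p′ q′ → ∀ a → eqTypeAt p q a ≡ eqTypeAt p′ q′ a
  orbit-≡⇒eqTypeAt same a =
    ≡.trans (Equivalence.to orbit≡⇔ same a) (≡.sym (Equivalence.to orbit≡⇔ ≡.refl a))

  orbitMatrix : Fin #orbits → Mat
  orbitMatrix j p q = ⟦ does (orbit p q ≟ j) ⟧

  combo-apply : ∀ k cs (B : Fin k → Mat) p q → combo k cs B p q ≈ sum λ i → cs i * B i p q
  combo-apply zero    cs B p q = refl
  combo-apply (suc k) cs B p q = +-congˡ (combo-apply k (cs ∘ Fin.suc) (B ∘ Fin.suc) p q)

  combo-orbitMatrix : ∀ cs p q → combo #orbits cs orbitMatrix p q ≈ cs (orbit p q)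
  combo-orbitMatrix cs p q = begin
    combo #orbits cs orbitMatrix p q              ≈⟨ combo-apply #orbits cs orbitMatrix p q ⟩
    sum (λ j → cs j * orbitMatrix j p q)          ≈⟨ sum-δ _ (orbit p q) off-orbit ⟩
    cs (orbit p q) * orbitMatrix (orbit p q) p q  ≈⟨ *-congˡ (⟦does⟧-yes (orbit p q ≟ orbit p q) ≡.refl) ⟩
    cs (orbit p q) * 1#                           ≈⟨ *-identityʳ _ ⟩
    cs (orbit p q)                                ∎
    where
    off-orbit : ∀ j → j ≢ orbit p q → cs j * orbitMatrix j p q ≈ 0#
    off-orbit j j≢ = trans (*-congˡ (⟦does⟧-no (orbit p q ≟ j) (j≢ ∘ ≡.sym))) (zeroʳ (cs j))

  ·M-congʳ : ∀ M {N N′} → N ≈M N′ → (M ·M N) ≈M (M ·M N′)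
  ·M-congʳ M N≈N′ p q = ∑Pt-cong (λ w → *-congˡ (N≈N′ w q))

  ≭-sym : ∀ {x y : Pt n u} → ¬ x ≋ y → ¬ y ≋ x
  ≭-sym x≭y y≋x = x≭y (≡.sym ∘ y≋x)

  IM-off : ∀ {x y} → ¬ x ≋ y → IM x y ≈ 0#
  IM-off x≭y = reflexive (≡.cong ⟦_⟧ (samePt-≭ x≭y))

  IM-diag : ∀ x → IM x x ≈ 1#
  IM-diag x = reflexive (≡.cong ⟦_⟧ (samePt-≋ {x} λ _ → ≡.refl))

  E*-off : ∀ g {x y} → ¬ x ≋ y → E* x₀ g x y ≈ 0#
  E*-off g {x} x≭y =
    reflexive (≡.cong ⟦_⟧ (≡.trans (≡.cong (inR g x₀ x ∧_) (samePt-≭ x≭y)) (Bool.∧-zeroʳ _)))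

  E*-diag : ∀ g x → E* x₀ g x x ≈ ⟦ inR g x₀ x ⟧
  E*-diag g x =
    reflexive (≡.cong ⟦_⟧ (≡.trans (≡.cong (inR g x₀ x ∧_) (samePt-≋ {x} λ _ → ≡.refl)) (Bool.∧-identityʳ _)))

  ·M-IM : ∀ {M} → Invariant M → (M ·M IM) ≈M M
  ·M-IM {M} M-inv p q = begin
    ∑Pt (λ w → M p w * IM w q)  ≈⟨ ∑Pt-δ q (·M-respects M-inv IM-invariant p q) off-diagonal ⟩
    M p q * IM q q              ≈⟨ *-congˡ (IM-diag q) ⟩
    M p q * 1#                  ≈⟨ *-identityʳ _ ⟩
    M p q                       ∎
    where
    off-diagonal : ∀ w → ¬ q ≋ w → M p w * IM w q ≈ 0#
    off-diagonal w q≭w = trans (*-congˡ (IM-off (≭-sym q≭w))) (zeroʳ _)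

  E*-· : ∀ g {N} → Invariant N → ∀ p q → (E* x₀ g ·M N) p q ≈ ⟦ inR g x₀ p ⟧ * N p q
  E*-· g {N} N-inv p q = begin
    ∑Pt (λ w → E* x₀ g p w * N w q)  ≈⟨ ∑Pt-δ p (·M-respects (E*-invariant g) N-inv p q) off-diagonal ⟩
    E* x₀ g p p * N p q              ≈⟨ *-congʳ (E*-diag g p) ⟩
    ⟦ inR g x₀ p ⟧ * N p q           ∎
    where
    off-diagonal : ∀ w → ¬ p ≋ w → E* x₀ g p w * N w q ≈ 0#
    off-diagonal w p≭w = trans (*-congʳ (E*-off g p≭w)) (zeroˡ _)

  ·-E* : ∀ g {M} → Invariant M → ∀ p q → (M ·M E* x₀ g) p q ≈ M p q * ⟦ inR g x₀ q ⟧
  ·-E* g {M} M-inv p q = begin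
    ∑Pt (λ w → M p w * E* x₀ g w q)  ≈⟨ ∑Pt-δ q (·M-respects M-inv (E*-invariant g) p q) off-diagonal ⟩
    M p q * E* x₀ g q q              ≈⟨ *-congˡ (E*-diag g q) ⟩
    M p q * ⟦ inR g x₀ q ⟧           ∎
    where
    off-diagonal : ∀ w → ¬ q ≋ w → M p w * E* x₀ g w q ≈ 0#
    off-diagonal w q≭w = trans (*-congˡ (E*-off g (≭-sym q≭w))) (zeroʳ _)

  InR : Fin (2 ^ n) → Pt n u → Pt n u → Fin n → Set
  InR g x y a = differ (x a) (y a) ≡ bit (toℕ g) (toℕ a)

  InR-fromBits⇔ : ∀ v (x y : Pt n u) a → (differ (x a) (y a) ≡ v a) ⇔ InR (fromBits n v) x y a
  InR-fromBits⇔ v x y a =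
    mk⇔ (λ e → ≡.trans e (≡.sym (bit-fromBits n v a))) (λ e → ≡.trans e (bit-fromBits n v a))

  -- The orbit j is cut out by E*_G A_H E*_K: the bits of G, H and K say in which
  -- coordinates p differs from x₀, q from p, and q from x₀.
  module _ (j : Fin #orbits) where

    G H K : Fin (2 ^ n)
    G = fromBits n (opBit ∘ typeOf j)
    H = fromBits n (pqBit ∘ typeOf j)
    K = fromBits n (oqBit ∘ typeOf j)

    orbitWord : List Gen
    orbitWord = inj₂ G ∷ inj₁ H ∷ inj₂ K ∷ []

    word-orbitWord : ∀ p q → word x₀ orbitWord p q ≈ ⟦ inR G x₀ p ⟧ * (⟦ inR H p q ⟧ * ⟦ inR K x₀ q ⟧)
    word-orbitWord p q = begin
      word x₀ orbitWord p q
        ≈⟨ ·M-congʳ (E* x₀ G) (·M-congʳ (A H) (·M-IM (E*-invariant K))) p q ⟩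
      (E* x₀ G ·M (A H ·M E* x₀ K)) p q
        ≈⟨ E*-· G (·M-invariant (A-invariant H) (E*-invariant K)) p q ⟩
      ⟦ inR G x₀ p ⟧ * (A H ·M E* x₀ K) p q
        ≈⟨ *-congˡ (·-E* K (A-invariant H) p q) ⟩
      ⟦ inR G x₀ p ⟧ * (⟦ inR H p q ⟧ * ⟦ inR K x₀ q ⟧) ∎

    eqTypeAt≡⇔ : ∀ p q a → eqTypeAt p q a ≡ typeOf j a ⇔ (InR G x₀ p a × InR H p q a × InR K x₀ q a)
    eqTypeAt≡⇔ p q a = ⇔.trans (eqType≡⇔ (x₀ a) (p a) (q a) typeOf<5)
      (InR-fromBits⇔ (opBit ∘ typeOf j) x₀ p a ×-⇔
       InR-fromBits⇔ (pqBit ∘ typeOf j) p q a ×-⇔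
       InR-fromBits⇔ (oqBit ∘ typeOf j) x₀ q a)
      where
      typeOf<5 : typeOf j a < 5
      typeOf<5 = <-≤-trans (toℕ<n (finToTuple n _ j a)) (#eqTypes≤5 (u a))

    orbit≡⇔InR : ∀ p q →
      orbit p q ≡ j ⇔ (All (InR G x₀ p) (allFin n) × All (InR H p q) (allFin n) × All (InR K x₀ q) (allFin n))
    orbit≡⇔InR p q = ⇔.trans orbit≡⇔ (mk⇔
      (λ types → tabulate⁺ (proj₁ ∘ to types) , tabulate⁺ (proj₁ ∘ proj₂ ∘ to types)
                                               , tabulate⁺ (proj₂ ∘ proj₂ ∘ to types))
      (λ (inG , inH , inK) a →
         Equivalence.from (eqTypeAt≡⇔ p q a) (tabulate⁻ inG a , tabulate⁻ inH a , tabulate⁻ inK a)))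
      where
      to : (∀ a → eqTypeAt p q a ≡ typeOf j a) → ∀ a → InR G x₀ p a × InR H p q a × InR K x₀ q a
      to types a = Equivalence.to (eqTypeAt≡⇔ p q a) (types a)

    orbitMatrix-inT : InT x₀ (orbitMatrix j)
    orbitMatrix-inT = ((1# , orbitWord) ∷ []) , λ p q → begin
      ⟦ does (orbit p q ≟ j) ⟧
        ≡⟨ ≡.cong ⟦_⟧ (does-⇔ (orbit≡⇔InR p q) (orbit p q ≟ j) (all? _ _ ×-dec all? _ _ ×-dec all? _ _)) ⟩
      ⟦ inR G x₀ p ∧ (inR H p q ∧ inR K x₀ q) ⟧
        ≈⟨ trans (⟦∧⟧ _ _) (*-congˡ (⟦∧⟧ _ _)) ⟩
      ⟦ inR G x₀ p ⟧ * (⟦ inR H p q ⟧ * ⟦ inR K x₀ q ⟧)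
        ≈⟨ word-orbitWord p q ⟨
      word x₀ orbitWord p q
        ≈⟨ trans (+-identityʳ _) (*-identityˡ _) ⟨
      lincomb x₀ ((1# , orbitWord) ∷ []) p q ∎

  module _ (2≤u : ∀ a → 2 ≤ u a) where

    realise : ∀ j a → Σ (Fin (u a) × Fin (u a)) λ (p , q) → eqType (x₀ a) p q ≡ typeOf j a
    realise j a = eqType-surjective (2≤u a) (x₀ a) (typeOf j a) (toℕ<n (finToTuple n _ j a))

    rep₁ rep₂ : Fin #orbits → Pt n u
    rep₁ j a = proj₁ (proj₁ (realise j a))
    rep₂ j a = proj₂ (proj₁ (realise j a))

    orbit-rep : ∀ j → orbit (rep₁ j) (rep₂ j) ≡ j
    orbit-rep j = Equivalence.from orbit≡⇔ (λ a → proj₂ (realise j a))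

    orbitMatrix-independent : ∀ cs → combo #orbits cs orbitMatrix ≈M 0M → ∀ j → cs j ≈ 0#
    orbitMatrix-independent cs combo≈0 j = begin
      cs j                                             ≡⟨ ≡.cong cs (orbit-rep j) ⟨
      cs (orbit (rep₁ j) (rep₂ j))                     ≈⟨ combo-orbitMatrix cs (rep₁ j) (rep₂ j) ⟨
      combo #orbits cs orbitMatrix (rep₁ j) (rep₂ j)   ≈⟨ combo≈0 (rep₁ j) (rep₂ j) ⟩
      0#                                               ∎

    orbitMatrix-spanning : ∀ M → InT x₀ M → M ≈M combo #orbits (λ j → M (rep₁ j) (rep₂ j)) orbitMatrix
    orbitMatrix-spanning M (l , M≈l) p q = begin
      M p q                  ≈⟨ M≈l p q ⟩
      lincomb x₀ l p q       ≈⟨ invariant-eqTypeAt (lincomb-invariant l) same-eqTypes ⟩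
      lincomb x₀ l r₁ r₂     ≈⟨ M≈l r₁ r₂ ⟨
      M r₁ r₂                ≈⟨ combo-orbitMatrix (λ j → M (rep₁ j) (rep₂ j)) p q ⟨
      combo #orbits (λ j → M (rep₁ j) (rep₂ j)) orbitMatrix p q ∎
      where
      r₁ = rep₁ (orbit p q)
      r₂ = rep₂ (orbit p q)
      same-eqTypes = orbit-≡⇒eqTypeAt (≡.sym (orbit-rep (orbit p q)))

    orbitMatrix-basis : IsBasisOfT x₀ #orbits orbitMatrix
    orbitMatrix-basis = record
      { inT         = orbitMatrix-inT
      ; independent = orbitMatrix-independent
      ; spanning    = λ M M∈T → (λ j → M (rep₁ j) (rep₂ j)) , orbitMatrix-spanning M M∈T
      }

formula≡∏#eqTypes : ∀ n u → formula n u ≡ MixedRadix.∏ n (EqualityTypes.#eqTypes ∘ u)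
formula≡∏#eqTypes n u =
  ≡.trans (Counting.formula-closed-form n u) (≡.sym (Counting.∏-if (λ a → 2 <? u a) 5 4 n id))

theorem4p6 : ∀ {c ℓ} (F : Field c ℓ) (n : ℕ) (u : Fin n → ℕ) → 1 ≤ n → (∀ a → 2 ≤ u a)
    → (x : Pt n u) → Terwilliger.DimT≡ F n u x (formula n u)
theorem4p6 F n u _ 2≤u x =
  ≡.subst (Terwilliger.DimT≡ F n u x) (≡.sym (formula≡∏#eqTypes n u))
          (orbitMatrix , orbitMatrix-basis 2≤u)
  where open Orbits F x
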